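{- Let $\mathcal L=\mathcal L_M$ with $M\subseteq\{\Diamond,\forall\}$ and let $\Lambda$ be an admissible intuitionistic temporal logic over $\mathcal L$. Let $P$ be the set of prime $\mathcal L$-types, ordered by $\Phi\preccurlyeq_c\Psi$ iff $\Phi^+\subseteq\Psi^+$ and $\Psi^-\subseteq\Phi^-$, and let $S_c=\{(\Phi,\Psi)\in P\times P:(\Phi,\Psi)\text{ is sensible}\}$. Then $S_c$ is a function $P\to P$ (every $\Phi\in P$ has exactly one $\Psi\in P$ with $\Phi\mathrel S_c\Psi$) which is continuous with respect to the up-set topology of $\preccurlyeq_c$, i.e. $\Phi\preccurlyeq_c\Psi$ implies $S_c(\Phi)\preccurlyeq_c S_c(\Psi)$. If moreover $\Lambda$ contains all substitution instances of $({\circ}\varphi\to{\circ}\psi)\to{\circ}(\varphi\to\psi)$, then $S_c$ is also open: whenever $S_c(\Phi)\preccurlyeq_c\Psi$ there is $\Theta\in P$ with $\Phi\preccurlyeq_c\Theta$ and $S_c(\Theta)=\Psi$.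
   Context: $\mathcal L_M$ is the propositional language with $\bot$, variables, $\wedge,\vee,\to$, ${\circ}$ and the modalities in $M$. ${\sf ITL}^0_M$ is the logic with all substitution instances of the intuitionistic propositional axioms and $\neg{\circ}\bot$, ${\circ}\varphi\wedge{\circ}\psi\to{\circ}(\varphi\wedge\psi)$, ${\circ}(\varphi\vee\psi)\to{\circ}\varphi\vee{\circ}\psi$, ${\circ}(\varphi\to\psi)\to({\circ}\varphi\to{\circ}\psi)$, closed under modus ponens and from $\varphi$ infer ${\circ}\varphi$; if $\Diamond\in M$ additionally the axiom $\varphi\vee{\circ}\Diamond\varphi\to\Diamond\varphi$ and rules from $\varphi\to\psi$ infer $\Diamond\varphi\to\Diamond\psi$, from ${\circ}\varphi\to\varphi$ infer $\Diamond\varphi\to\varphi$; if $\forall\in M$ additionally $\forall\varphi\vee\neg\forall\varphi$, $\forall(\varphi\to\psi)\to(\forall\varphi\to\forall\psi)$, $\forall(\varphi\vee\forall\psi)\to\forall\varphi\vee\forall\psi$, $\forall\varphi\to\varphi$, $\forall\varphi\to\forall\forall\varphi$, $\forall\varphi\leftrightarrow{\circ}\forall\varphi$ and the rule from $\varphi$ infer $\forall\varphi$. An admissible intuitionistic temporal logic over $\mathcal L_M$ is a set $\Lambda$ of $\mathcal L_M$-formulas containing all substitution instances of the axioms of ${\sf ITL}^0_M$ and closed under its rules. $\Gamma\vdash\Delta$ means there are finite $\Gamma'\subseteq\Gamma$, $\Delta'\subseteq\Delta$ with $\bigwedge\Gamma'\to\bigvee\Delta'\in\Lambda$. A prime $\mathcal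 L$-type is a pair $(\Phi^+,\Phi^-)$ with $\Phi^+\cup\Phi^-=\mathcal L$ and $\Phi^+\not\vdash\Phi^-$. A pair $(\Phi,\Psi)$ is sensible if: ${\circ}\varphi\in\Phi^+\Rightarrow\varphi\in\Psi^+$; ${\circ}\varphi\in\Phi^-\Rightarrow\varphi\in\Psi^-$; $\Diamond\varphi\in\Phi^+\Rightarrow\varphi\in\Phi^+$ or $\Diamond\varphi\in\Psi^+$; $\Diamond\varphi\in\Phi^-\Rightarrow\Diamond\varphi\in\Psi^-$; $\forall\varphi\in\Phi^+\Leftrightarrow\forall\varphi\in\Psi^+$; $\forall\varphi\in\Phi^-\Leftrightarrow\forall\varphi\in\Psi^-$. -}

module Defs where

open import Data.Bool using (Bool; T)
open import Data.Nat using (ℕ)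
open import Data.List using (List; []; _∷_)
open import Data.List.Relation.Unary.All using (All)
open import Data.Product using (Σ; _×_; _,_)
open import Data.Sum using (_⊎_)
open import Level using (0ℓ)
open import Relation.Unary using (Pred; _⊆_)
open import Relation.Nullary using (¬_)

-- The set M ⊆ {◇, ∀} of modalities, given by two flags.
record Mods : Set where
  field
    dia : Bool
    all : Bool
open Mods public

-- The language L_M.  ◇ and ∀ can only be used if they belong to M.
data Fm (M : Mods) : Set where
  var  : ℕ → Fm M
  ⊥'   : Fm M
  _∧'_ : Fm M → Fm M → Fm M
  _∨'_ : Fm M → Fm M → Fm M
  _⇒_  : Fm M → Fm M → Fm M
  ○    : Fm M → Fm M
  ◇    : T (dia M) → Fm M → Fm M
  A    : T (all M) → Fm M → Fm M

infixr 6 _∧'_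
infixr 5 _∨'_
infixr 4 _⇒_

module _ {M : Mods} where
  ¬'_ : Fm M → Fm M
  ¬' φ = φ ⇒ ⊥'

  ⊤' : Fm M
  ⊤' = ⊥' ⇒ ⊥'

  _⇔_ : Fm M → Fm M → Fm M
  φ ⇔ ψ = (φ ⇒ ψ) ∧' (ψ ⇒ φ)

  ⋀ : List (Fm M) → Fm M
  ⋀ [] = ⊤'
  ⋀ (φ ∷ φs) = φ ∧' ⋀ φs

  ⋁ : List (Fm M) → Fm M
  ⋁ [] = ⊥'
  ⋁ (φ ∷ φs) = φ ∨' ⋁ φs

-- Admissible intuitionistic temporal logics over L_M:
-- sets containing all instances of the axioms of ITL⁰_M, closed under its rules.
-- (Intuitionistic propositional logic is given by a standard Hilbert axiomatisation.)
record IsAdmissible (M : Mods) (Λ : Pred (Fm M) 0ℓ) : Set where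
  field
    ax-K   : ∀ φ ψ → Λ (φ ⇒ ψ ⇒ φ)
    ax-S   : ∀ φ ψ χ → Λ ((φ ⇒ ψ ⇒ χ) ⇒ (φ ⇒ ψ) ⇒ φ ⇒ χ)
    ax-∧E₁ : ∀ φ ψ → Λ (φ ∧' ψ ⇒ φ)
    ax-∧E₂ : ∀ φ ψ → Λ (φ ∧' ψ ⇒ ψ)
    ax-∧I  : ∀ φ ψ → Λ (φ ⇒ ψ ⇒ φ ∧' ψ)
    ax-∨I₁ : ∀ φ ψ → Λ (φ ⇒ φ ∨' ψ)
    ax-∨I₂ : ∀ φ ψ → Λ (ψ ⇒ φ ∨' ψ)
    ax-∨E  : ∀ φ ψ χ → Λ ((φ ⇒ χ) ⇒ (ψ ⇒ χ) ⇒ φ ∨' ψ ⇒ χ)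
    ax-⊥   : ∀ φ → Λ (⊥' ⇒ φ)
    ax-○⊥  : Λ (¬' ○ ⊥')
    ax-○∧  : ∀ φ ψ → Λ (○ φ ∧' ○ ψ ⇒ ○ (φ ∧' ψ))
    ax-○∨  : ∀ φ ψ → Λ (○ (φ ∨' ψ) ⇒ ○ φ ∨' ○ ψ)
    ax-○⇒  : ∀ φ ψ → Λ (○ (φ ⇒ ψ) ⇒ ○ φ ⇒ ○ ψ)
    mp     : ∀ {φ ψ} → Λ (φ ⇒ ψ) → Λ φ → Λ ψ
    nec○   : ∀ {φ} → Λ φ → Λ (○ φ)
    ax-◇   : ∀ (d : T (dia M)) φ → Λ (φ ∨' ○ (◇ d φ) ⇒ ◇ d φ)
    mon-◇  : ∀ (d : T (dia M)) {φ ψ} → Λ (φ ⇒ ψ) → Λ (◇ d φ ⇒ ◇ d ψ)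
    ind-◇  : ∀ (d : T (dia M)) {φ} → Λ (○ φ ⇒ φ) → Λ (◇ d φ ⇒ φ)
    ax-A-lem : ∀ (a : T (all M)) φ → Λ (A a φ ∨' ¬' A a φ)
    ax-A-K   : ∀ (a : T (all M)) φ ψ → Λ (A a (φ ⇒ ψ) ⇒ A a φ ⇒ A a ψ)
    ax-A-∨   : ∀ (a : T (all M)) φ ψ → Λ (A a (φ ∨' A a ψ) ⇒ A a φ ∨' A a ψ)
    ax-A-T   : ∀ (a : T (all M)) φ → Λ (A a φ ⇒ φ)
    ax-A-4   : ∀ (a : T (all M)) φ → Λ (A a φ ⇒ A a (A a φ))
    ax-A-○   : ∀ (a : T (all M)) φ → Λ (A a φ ⇔ ○ (A a φ))
    nec-A    : ∀ (a : T (all M)) {φ} → Λ φ → Λ (A a φ)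

module _ {M : Mods} (Λ : Pred (Fm M) 0ℓ) where

  _⊢_ : Pred (Fm M) 0ℓ → Pred (Fm M) 0ℓ → Set
  Γ ⊢ Δ = Σ (List (Fm M)) λ Γ' → Σ (List (Fm M)) λ Δ' →
            All Γ Γ' × All Δ Δ' × Λ (⋀ Γ' ⇒ ⋁ Δ')

  record PrimeType : Set₁ where
    field
      pos   : Pred (Fm M) 0ℓ
      neg   : Pred (Fm M) 0ℓ
      cover : ∀ φ → pos φ ⊎ neg φ
      cons  : ¬ (pos ⊢ neg)
  open PrimeType public

  _≼_ : PrimeType → PrimeType → Set
  Φ ≼ Ψ = (pos Φ ⊆ pos Ψ) × (neg Ψ ⊆ neg Φ)

  record Sensible (Φ Ψ : PrimeType) : Set where
    field
      ○⁺ : ∀ {φ} → pos Φ (○ φ) → pos Ψ φ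
      ○⁻ : ∀ {φ} → neg Φ (○ φ) → neg Ψ φ
      ◇⁺ : ∀ d {φ} → pos Φ (◇ d φ) → pos Φ φ ⊎ pos Ψ (◇ d φ)
      ◇⁻ : ∀ d {φ} → neg Φ (◇ d φ) → neg Ψ (◇ d φ)
      A⁺→ : ∀ a {φ} → pos Φ (A a φ) → pos Ψ (A a φ)
      A⁺← : ∀ a {φ} → pos Ψ (A a φ) → pos Φ (A a φ)
      A⁻→ : ∀ a {φ} → neg Φ (A a φ) → neg Ψ (A a φ)
      A⁻← : ∀ a {φ} → neg Ψ (A a φ) → neg Φ (A a φ)

-- A sensible pair is determined by its ○-clauses: the ◇- and ∀-clauses follow
-- from ◇φ ↔ φ ∨ ○◇φ and ∀φ ↔ ○∀φ.  So S_c is the map Φ ↦ (○⁻¹Φ⁺, ○⁻¹Φ⁻),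
-- which is evidently total, single-valued and monotone.  For openness, given
-- S_c(Φ) ≼ Ψ, extend (Φ⁺ ∪ ○Ψ⁺, ○Ψ⁻) to a prime type Θ by Lindenbaum's lemma.
-- This pair is consistent: a derivation ⋀Γ ∧ ○⋀Δ → ○⋁Σ with Γ ⊆ Φ⁺ puts
-- ○⋀Δ → ○⋁Σ into Φ⁺, hence ○(⋀Δ → ⋁Σ) by the extra axiom, so ⋀Δ → ⋁Σ lies in
-- S_c(Φ)⁺ ⊆ Ψ⁺, which is impossible for Δ ⊆ Ψ⁺ and Σ ⊆ Ψ⁻.
module Submission where

open import Defs
open import Level using (0ℓ)
open import Axiom.ExcludedMiddle using (ExcludedMiddle)
open import Data.Bool using (Bool; true; false; T)
open import Data.Empty using (⊥; ⊥-elim)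
open import Data.List using (List; []; _∷_; _++_; map; concat; cartesianProductWith)
open import Data.List.Membership.Propositional using (_∈_)
open import Data.List.Membership.Propositional.Properties
  using (∈-++⁺ˡ; ∈-++⁺ʳ; ∈-map⁺; ∈-concat⁺′; ∈-cartesianProductWith⁺)
open import Data.List.Relation.Unary.All using (All; []; _∷_)
import Data.List.Relation.Unary.All as All
open import Data.List.Relation.Unary.All.Properties using (map⁺; ++⁺)
open import Data.List.Relation.Unary.Any using (here; there)
open import Data.Nat using (ℕ; zero; suc; _≤_; _≤′_; ≤′-refl; ≤′-step; _⊔_)
open import Data.Nat.Properties using (≤⇒≤′; m≤m⊔n; m≤n⊔m)
open import Data.Product using (_×_; ∃-syntax; _,_; proj₁; proj₂)
open import Data.Sum using (_⊎_; inj₁; inj₂; map₂)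
import Data.Sum as Sum
open import Data.Unit using (tt)
open import Relation.Binary.PropositionalEquality using (_≡_; refl)
open import Relation.Nullary using (¬_; yes; no)
open import Relation.Unary using (Pred; _⊆_; _∪_; ｛_｝; ⋃)

module Ascending {A : Set} (Q : ℕ → Pred A 0ℓ) (step : ∀ n → Q n ⊆ Q (suc n)) where

  mono′ : ∀ {m n} → m ≤′ n → Q m ⊆ Q n
  mono′ ≤′-refl q = q
  mono′ (≤′-step m≤n) q = step _ (mono′ m≤n q)

  mono : ∀ {m n} → m ≤ n → Q m ⊆ Q n
  mono m≤n = mono′ (≤⇒≤′ m≤n)

  All-⋃ : ∀ {xs} → All (⋃ ℕ Q) xs → ∃[ n ] All (Q n) xs
  All-⋃ [] = 0 , []
  All-⋃ ((m , q) ∷ qs) with All-⋃ qs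
  ... | n , qs′ = m ⊔ n , mono (m≤m⊔n m n) q ∷ All.map (mono (m≤n⊔m m n)) qs′

module Enumeration (M : Mods) where

  elements : (b : Bool) → List (T b)
  elements true = tt ∷ []
  elements false = []

  ∈-elements : ∀ b (t : T b) → t ∈ elements b
  ∈-elements true tt = here refl

  -- Stage n + 1 adds var n and all formulas one connective above stage n.
  blocks : ℕ → List (Fm M) → List (List (Fm M))
  blocks n L =
    (⊥' ∷ var n ∷ []) ∷ map ○ L ∷
    cartesianProductWith ◇ (elements (dia M)) L ∷
    cartesianProductWith A (elements (all M)) L ∷
    cartesianProductWith _∧'_ L L ∷ cartesianProductWith _∨'_ L L ∷
    cartesianProductWith _⇒_ L L ∷ []

  formulas : ℕ → List (Fm M)
  formulas zero = []
  formulas (suc n) = formulas n ++ concat (blocks n (formulas n))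

  open Ascending (λ n → _∈ formulas n) (λ n → ∈-++⁺ˡ)
    using () renaming (mono to formulas-mono)

  ∈-blocks : ∀ n {φ xs} → φ ∈ xs → xs ∈ blocks n (formulas n) → φ ∈ formulas (suc n)
  ∈-blocks n φ∈xs xs∈blocks = ∈-++⁺ʳ (formulas n) (∈-concat⁺′ φ∈xs xs∈blocks)

  ∈-binary : ∀ (_∙_ : Fm M → Fm M → Fm M) →
             (∀ n L → cartesianProductWith _∙_ L L ∈ blocks n L) →
             ∀ {φ ψ} → ∃[ a ] φ ∈ formulas a → ∃[ b ] ψ ∈ formulas b →
             ∃[ n ] (φ ∙ ψ) ∈ formulas n
  ∈-binary _∙_ block (a , φ∈) (b , ψ∈) =
    suc (a ⊔ b) ,
    ∈-blocks (a ⊔ b) (∈-cartesianProductWith⁺ _∙_ (formulas-mono (m≤m⊔n a b) φ∈)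
                                                  (formulas-mono (m≤n⊔m a b) ψ∈))
                     (block _ _)

  formulas-complete : ∀ φ → ∃[ n ] φ ∈ formulas n
  formulas-complete ⊥' = 1 , ∈-blocks 0 (here refl) (here refl)
  formulas-complete (var i) = suc i , ∈-blocks i (there (here refl)) (here refl)
  formulas-complete (○ φ) with formulas-complete φ
  ... | n , φ∈ = suc n , ∈-blocks n (∈-map⁺ ○ φ∈) (there (here refl))
  formulas-complete (◇ d φ) with formulas-complete φ
  ... | n , φ∈ = suc n , ∈-blocks n (∈-cartesianProductWith⁺ ◇ (∈-elements _ d) φ∈)
                                    (there (there (here refl)))
  formulas-complete (A a φ) with formulas-complete φ
  ... | n , φ∈ = suc n , ∈-blocks n (∈-cartesianProductWith⁺ A (∈-elements _ a) φ∈)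
                                    (there (there (there (here refl))))
  formulas-complete (φ ∧' ψ) =
    ∈-binary _∧'_ (λ _ _ → there (there (there (there (here refl)))))
             (formulas-complete φ) (formulas-complete ψ)
  formulas-complete (φ ∨' ψ) =
    ∈-binary _∨'_ (λ _ _ → there (there (there (there (there (here refl))))))
             (formulas-complete φ) (formulas-complete ψ)
  formulas-complete (φ ⇒ ψ) =
    ∈-binary _⇒_ (λ _ _ → there (there (there (there (there (there (here refl)))))))
             (formulas-complete φ) (formulas-complete ψ)

module _ {M : Mods} {Λ : Pred (Fm M) 0ℓ} (adm : IsAdmissible M Λ) where
  open IsAdmissible adm
  open Enumeration M using (formulas; formulas-complete)

  private
    variable
      α β γ δ φ ψ θ : Fm M
      G D : List (Fm M)
      Γ Δ Π : Pred (Fm M) 0ℓ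

  ⇒-refl : Λ (φ ⇒ φ)
  ⇒-refl {φ} = mp (mp (ax-S φ (φ ⇒ φ) φ) (ax-K φ (φ ⇒ φ))) (ax-K φ φ)

  weaken : ∀ α → Λ θ → Λ (α ⇒ θ)
  weaken α h = mp (ax-K _ α) h

  ⇒-app : Λ (α ⇒ β ⇒ γ) → Λ (α ⇒ β) → Λ (α ⇒ γ)
  ⇒-app f g = mp (mp (ax-S _ _ _) f) g

  ⇒-trans : Λ (α ⇒ β) → Λ (β ⇒ γ) → Λ (α ⇒ γ)
  ⇒-trans {α} f g = ⇒-app (weaken α g) f

  ∧-fst : Λ (α ∧' β ⇒ α)
  ∧-fst = ax-∧E₁ _ _

  ∧-snd : Λ (α ∧' β ⇒ β)
  ∧-snd = ax-∧E₂ _ _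

  ∨-inl : Λ (α ⇒ α ∨' β)
  ∨-inl = ax-∨I₁ _ _

  ∨-inr : Λ (β ⇒ α ∨' β)
  ∨-inr = ax-∨I₂ _ _

  ⟨_,_⟩ : Λ (α ⇒ β) → Λ (α ⇒ γ) → Λ (α ⇒ β ∧' γ)
  ⟨ f , g ⟩ = ⇒-app (⇒-trans f (ax-∧I _ _)) g

  [_,_] : Λ (α ⇒ γ) → Λ (β ⇒ γ) → Λ (α ∨' β ⇒ γ)
  [ f , g ] = mp (mp (ax-∨E _ _ _) f) g

  ∨-elim-under : Λ (α ⇒ β ⇒ γ) → Λ (α ⇒ δ ⇒ γ) → Λ (α ⇒ β ∨' δ ⇒ γ)
  ∨-elim-under {α} f g = ⇒-app (⇒-app (weaken α (ax-∨E _ _ _)) f) g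

  curry : Λ (α ∧' β ⇒ γ) → Λ (α ⇒ β ⇒ γ)
  curry {α} {β} h = ⇒-trans (ax-∧I α β) (mp (ax-S β _ _) (weaken β h))

  uncurry : Λ (α ⇒ β ⇒ γ) → Λ (α ∧' β ⇒ γ)
  uncurry f = ⇒-app (⇒-trans ∧-fst f) ∧-snd

  ∧-map : Λ (α ⇒ γ) → Λ (β ⇒ δ) → Λ (α ∧' β ⇒ γ ∧' δ)
  ∧-map f g = ⟨ ⇒-trans ∧-fst f , ⇒-trans ∧-snd g ⟩

  ∨-map : Λ (α ⇒ γ) → Λ (β ⇒ δ) → Λ (α ∨' β ⇒ γ ∨' δ)
  ∨-map f g = [ ⇒-trans f ∨-inl , ⇒-trans g ∨-inr ]

  ○-map : Λ (φ ⇒ ψ) → Λ (○ φ ⇒ ○ ψ)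
  ○-map h = mp (ax-○⇒ _ _) (nec○ h)

  -- ◇φ is below every χ with ○χ → χ and φ → χ; take χ = φ ∨ ○◇φ.
  ◇-unfold : ∀ d φ → Λ (◇ d φ ⇒ φ ∨' ○ (◇ d φ))
  ◇-unfold d φ = ⇒-trans (mon-◇ d ∨-inl) (ind-◇ d ○-closed)
    where
    ○-closed : Λ (○ (φ ∨' ○ (◇ d φ)) ⇒ φ ∨' ○ (◇ d φ))
    ○-closed = ⇒-trans (ax-○∨ _ _)
      (⇒-trans [ ○-map (⇒-trans ∨-inl (ax-◇ d φ)) , ○-map (⇒-trans ∨-inr (ax-◇ d φ)) ]
               ∨-inr)

  ⋀-++ : ∀ G H → Λ (⋀ (G ++ H) ⇒ ⋀ G ∧' ⋀ H)
  ⋀-++ [] H = ⟨ weaken _ ⇒-refl , ⇒-refl ⟩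
  ⋀-++ (γ ∷ G) H =
    ⇒-trans (∧-map ⇒-refl (⋀-++ G H)) ⟨ ∧-map ⇒-refl ∧-fst , ⇒-trans ∧-snd ∧-snd ⟩

  ⋁-++ : ∀ D E → Λ (⋁ D ∨' ⋁ E ⇒ ⋁ (D ++ E))
  ⋁-++ [] E = [ ax-⊥ _ , ⇒-refl ]
  ⋁-++ (δ ∷ D) E =
    ⇒-trans [ ∨-map ⇒-refl ∨-inl , ⇒-trans ∨-inr ∨-inr ] (∨-map ⇒-refl (⋁-++ D E))

  ⋀-split-∪ : All (Γ ∪ Δ) G →
              ∃[ G₁ ] ∃[ G₂ ] All Γ G₁ × All Δ G₂ × Λ (⋀ G₁ ∧' ⋀ G₂ ⇒ ⋀ G)
  ⋀-split-∪ [] = [] , [] , [] , [] , weaken _ ⇒-refl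
  ⋀-split-∪ (inj₁ γ∈ ∷ G⊆) with ⋀-split-∪ G⊆
  ... | G₁ , G₂ , G₁⊆ , G₂⊆ , h =
    _ ∷ G₁ , G₂ , γ∈ ∷ G₁⊆ , G₂⊆ , ⟨ ⇒-trans ∧-fst ∧-fst , ⇒-trans (∧-map ∧-snd ⇒-refl) h ⟩
  ⋀-split-∪ (inj₂ γ∈ ∷ G⊆) with ⋀-split-∪ G⊆
  ... | G₁ , G₂ , G₁⊆ , G₂⊆ , h =
    G₁ , _ ∷ G₂ , G₁⊆ , γ∈ ∷ G₂⊆ , ⟨ ⇒-trans ∧-snd ∧-fst , ⇒-trans (∧-map ⇒-refl ∧-snd) h ⟩

  ⋁-split-∪ : All (Γ ∪ Δ) D →
              ∃[ D₁ ] ∃[ D₂ ] All Γ D₁ × All Δ D₂ × Λ (⋁ D ⇒ ⋁ D₁ ∨' ⋁ D₂)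
  ⋁-split-∪ [] = [] , [] , [] , [] , ax-⊥ _
  ⋁-split-∪ (inj₁ δ∈ ∷ D⊆) with ⋁-split-∪ D⊆
  ... | D₁ , D₂ , D₁⊆ , D₂⊆ , h =
    _ ∷ D₁ , D₂ , δ∈ ∷ D₁⊆ , D₂⊆ , [ ⇒-trans ∨-inl ∨-inl , ⇒-trans h (∨-map ∨-inr ⇒-refl) ]
  ⋁-split-∪ (inj₂ δ∈ ∷ D⊆) with ⋁-split-∪ D⊆
  ... | D₁ , D₂ , D₁⊆ , D₂⊆ , h =
    D₁ , _ ∷ D₂ , D₁⊆ , δ∈ ∷ D₂⊆ , [ ⇒-trans ∨-inl ∨-inr , ⇒-trans h (∨-map ⇒-refl ∨-inr) ]

  ⋀-｛｝ : All ｛ φ ｝ G → Λ (φ ⇒ ⋀ G)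
  ⋀-｛｝ [] = weaken _ ⇒-refl
  ⋀-｛｝ (refl ∷ G≡) = ⟨ ⇒-refl , ⋀-｛｝ G≡ ⟩

  ⋁-｛｝ : All ｛ φ ｝ D → Λ (⋁ D ⇒ φ)
  ⋁-｛｝ [] = ax-⊥ _
  ⋁-｛｝ (refl ∷ D≡) = [ ⇒-refl , ⋁-｛｝ D≡ ]

  ⊢-cut : _⊢_ Λ (Γ ∪ ｛ φ ｝) Δ → _⊢_ Λ Γ (Δ ∪ ｛ φ ｝) → _⊢_ Λ Γ Δ
  ⊢-cut {φ = φ} (G , D₁ , G⊆ , D₁⊆ , h₁) (G₂ , D , G₂⊆ , D⊆ , h₂)
    with ⋀-split-∪ G⊆ | ⋁-split-∪ D⊆
  ... | G₁ , Gφ , G₁⊆ , Gφ≡ , g | D₂ , Dφ , D₂⊆ , Dφ≡ , d =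
    G₁ ++ G₂ , D₁ ++ D₂ , ++⁺ G₁⊆ G₂⊆ , ++⁺ D₁⊆ D₂⊆ ,
    ⇒-trans (⋀-++ G₁ G₂) (⇒-trans by-cases (⋁-++ D₁ D₂))
    where
    φ-left : Λ (⋀ G₁ ∧' φ ⇒ ⋁ D₁)
    φ-left = ⇒-trans (∧-map ⇒-refl (⋀-｛｝ Gφ≡)) (⇒-trans g h₁)
    φ-right : Λ (⋀ G₂ ⇒ ⋁ D₂ ∨' φ)
    φ-right = ⇒-trans h₂ (⇒-trans d (∨-map ⇒-refl (⋁-｛｝ Dφ≡)))
    by-cases : Λ (⋀ G₁ ∧' ⋀ G₂ ⇒ ⋁ D₁ ∨' ⋁ D₂)
    by-cases = ⇒-app (∨-elim-under (weaken _ ∨-inr)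
                                    (⇒-trans ∧-fst (curry (⇒-trans φ-left ∨-inl))))
                     (⇒-trans ∧-snd φ-right)

  ○-⋀ : ∀ G → Λ (⋀ (map ○ G) ⇒ ○ (⋀ G))
  ○-⋀ [] = weaken _ (nec○ ⇒-refl)
  ○-⋀ (γ ∷ G) = ⇒-trans (∧-map ⇒-refl (○-⋀ G)) (ax-○∧ _ _)

  ○-⋁ : ∀ D → Λ (○ (⋁ D) ⇒ ⋁ (map ○ D))
  ○-⋁ [] = ax-○⊥
  ○-⋁ (δ ∷ D) = ⇒-trans (ax-○∨ _ _) (∨-map ⇒-refl (○-⋁ D))

  ⊢-○ : _⊢_ Λ (λ φ → Γ (○ φ)) (λ φ → Δ (○ φ)) → _⊢_ Λ Γ Δ
  ⊢-○ (G , D , G⊆ , D⊆ , h) =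
    map ○ G , map ○ D , map⁺ G⊆ , map⁺ D⊆ , ⇒-trans (○-⋀ G) (⇒-trans (○-map h) (○-⋁ D))

  ○[_] : Pred (Fm M) 0ℓ → Pred (Fm M) 0ℓ
  ○[ Π ] χ = ∃[ φ ] χ ≡ ○ φ × Π φ

  ⋀-○[] : All ○[ Π ] G → ∃[ G′ ] All Π G′ × Λ (○ (⋀ G′) ⇒ ⋀ G)
  ⋀-○[] [] = [] , [] , weaken _ ⇒-refl
  ⋀-○[] ((φ , refl , φ∈) ∷ G⊆) with ⋀-○[] G⊆
  ... | G′ , G′⊆ , h = φ ∷ G′ , φ∈ ∷ G′⊆ , ⟨ ○-map ∧-fst , ⇒-trans (○-map ∧-snd) h ⟩

  ⋁-○[] : All ○[ Π ] D → ∃[ D′ ] All Π D′ × Λ (⋁ D ⇒ ○ (⋁ D′))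
  ⋁-○[] [] = [] , [] , ax-⊥ _
  ⋁-○[] ((φ , refl , φ∈) ∷ D⊆) with ⋁-○[] D⊆
  ... | D′ , D′⊆ , h = φ ∷ D′ , φ∈ ∷ D′⊆ , [ ○-map ∨-inl , ⇒-trans h (○-map ∨-inr) ]

  module _ (Φ : PrimeType Λ) where

    pos-neg-disjoint : pos Φ φ → neg Φ φ → ⊥
    pos-neg-disjoint {φ} p n = cons Φ (φ ∷ [] , φ ∷ [] , p ∷ [] , n ∷ [] , ⇒-trans ∧-fst ∨-inl)

    ¬neg⇒pos : ¬ neg Φ φ → pos Φ φ
    ¬neg⇒pos {φ} ¬n = Sum.[ (λ p → p) , (λ n → ⊥-elim (¬n n)) ] (cover Φ φ)

    ¬pos⇒neg : ¬ pos Φ φ → neg Φ φ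
    ¬pos⇒neg {φ} ¬p = Sum.[ (λ p → ⊥-elim (¬p p)) , (λ n → n) ] (cover Φ φ)

    pos-⋀-closed : All (pos Φ) G → Λ (⋀ G ⇒ φ) → pos Φ φ
    pos-⋀-closed {G} G⊆ h =
      ¬neg⇒pos λ n → cons Φ (G , _ ∷ [] , G⊆ , n ∷ [] , ⇒-trans h ∨-inl)

    pos-mp : pos Φ φ → Λ (φ ⇒ ψ) → pos Φ ψ
    pos-mp p h = pos-⋀-closed (p ∷ []) (⇒-trans ∧-fst h)

    neg-closed : neg Φ ψ → Λ (φ ⇒ ψ) → neg Φ φ
    neg-closed n h = ¬pos⇒neg λ p → pos-neg-disjoint (pos-mp p h) n

    pos-prime : pos Φ (φ ∨' ψ) → pos Φ φ ⊎ pos Φ ψ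
    pos-prime {φ} {ψ} p with cover Φ φ | cover Φ ψ
    ... | inj₁ φ∈ | _ = inj₁ φ∈
    ... | inj₂ _ | inj₁ ψ∈ = inj₂ ψ∈
    ... | inj₂ φ∉ | inj₂ ψ∉ =
      ⊥-elim (cons Φ (_ ∷ [] , φ ∷ ψ ∷ [] , p ∷ [] , φ∉ ∷ ψ∉ ∷ [] ,
                      ⇒-trans ∧-fst (∨-map ⇒-refl ∨-inl)))

  ≼-refl : (Φ : PrimeType Λ) → _≼_ Λ Φ Φ
  ≼-refl Φ = (λ p → p) , (λ n → n)

  ≼-from-pos : (Φ Ψ : PrimeType Λ) → pos Φ ⊆ pos Ψ → _≼_ Λ Φ Ψ
  ≼-from-pos Φ Ψ Φ⊆Ψ = Φ⊆Ψ , λ n → ¬pos⇒neg Φ λ p → pos-neg-disjoint Ψ (Φ⊆Ψ p) n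

  module _ (Φ Ψ : PrimeType Λ) where

    ○-reflects-pos : (∀ {φ} → neg Φ (○ φ) → neg Ψ φ) → pos Ψ φ → pos Φ (○ φ)
    ○-reflects-pos ○⁻ p = ¬neg⇒pos Φ λ n → pos-neg-disjoint Ψ p (○⁻ n)

    ○-reflects-neg : (∀ {φ} → pos Φ (○ φ) → pos Ψ φ) → neg Ψ φ → neg Φ (○ φ)
    ○-reflects-neg ○⁺ n = ¬pos⇒neg Φ λ p → pos-neg-disjoint Ψ (○⁺ p) n

    sensible-from-○ : (∀ {φ} → pos Φ (○ φ) → pos Ψ φ) →
                      (∀ {φ} → neg Φ (○ φ) → neg Ψ φ) → Sensible Λ Φ Ψ
    sensible-from-○ ○⁺ ○⁻ = record
      { ○⁺ = ○⁺
      ; ○⁻ = ○⁻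
      ; ◇⁺ = λ d {φ} p → map₂ ○⁺ (pos-prime Φ (pos-mp Φ p (◇-unfold d φ)))
      ; ◇⁻ = λ d {φ} n → ○⁻ (neg-closed Φ n (⇒-trans ∨-inr (ax-◇ d φ)))
      ; A⁺→ = λ a {φ} p → ○⁺ (pos-mp Φ p (mp ∧-fst (ax-A-○ a φ)))
      ; A⁺← = λ a {φ} p → pos-mp Φ (○-reflects-pos ○⁻ p) (mp ∧-snd (ax-A-○ a φ))
      ; A⁻→ = λ a {φ} n → ○⁻ (neg-closed Φ n (mp ∧-snd (ax-A-○ a φ)))
      ; A⁻← = λ a {φ} n → neg-closed Φ (○-reflects-neg ○⁺ n) (mp ∧-fst (ax-A-○ a φ))
      }

  next : PrimeType Λ → PrimeType Λ
  next Φ = record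
    { pos = λ φ → pos Φ (○ φ)
    ; neg = λ φ → neg Φ (○ φ)
    ; cover = λ φ → cover Φ (○ φ)
    ; cons = λ ⊢ → cons Φ (⊢-○ ⊢)
    }

  next-sensible : (Φ : PrimeType Λ) → Sensible Λ Φ (next Φ)
  next-sensible Φ = sensible-from-○ Φ (next Φ) (λ p → p) (λ n → n)

  sensible-monotone : (Φ Ψ Φ′ Ψ′ : PrimeType Λ) → Sensible Λ Φ Φ′ → Sensible Λ Ψ Ψ′ →
                      _≼_ Λ Φ Ψ → _≼_ Λ Φ′ Ψ′
  sensible-monotone Φ Ψ Φ′ Ψ′ s t (Φ⊆Ψ , _) = ≼-from-pos Φ′ Ψ′ λ p →
    Sensible.○⁺ t (Φ⊆Ψ (○-reflects-pos Φ Φ′ (Sensible.○⁻ s) p))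

  module _ (em : ExcludedMiddle 0ℓ) where

    record Sequent : Set₁ where
      constructor _▹_
      field
        lhs rhs : Pred (Fm M) 0ℓ
    open Sequent

    Consistent : Sequent → Set
    Consistent (Γ ▹ Δ) = ¬ (_⊢_ Λ Γ Δ)

    _⊑_ : Sequent → Sequent → Set
    s ⊑ t = (lhs s ⊆ lhs t) × (rhs s ⊆ rhs t)

    extend : Fm M → Sequent → Sequent
    extend φ (Γ ▹ Δ) with em {_⊢_ Λ (Γ ∪ ｛ φ ｝) Δ}
    ... | yes _ = Γ ▹ (Δ ∪ ｛ φ ｝)
    ... | no _ = (Γ ∪ ｛ φ ｝) ▹ Δ

    extend-consistent : ∀ φ s → Consistent s → Consistent (extend φ s)
    extend-consistent φ (Γ ▹ Δ) c with em {_⊢_ Λ (Γ ∪ ｛ φ ｝) Δ}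
    ... | yes ⊢φ = λ ⊢¬φ → c (⊢-cut ⊢φ ⊢¬φ)
    ... | no ⊬φ = ⊬φ

    extend-⊒ : ∀ φ s → s ⊑ extend φ s
    extend-⊒ φ (Γ ▹ Δ) with em {_⊢_ Λ (Γ ∪ ｛ φ ｝) Δ}
    ... | yes _ = (λ p → p) , inj₁
    ... | no _ = inj₁ , (λ n → n)

    extend-decides : ∀ φ s → lhs (extend φ s) φ ⊎ rhs (extend φ s) φ
    extend-decides φ (Γ ▹ Δ) with em {_⊢_ Λ (Γ ∪ ｛ φ ｝) Δ}
    ... | yes _ = inj₂ (inj₂ refl)
    ... | no _ = inj₁ (inj₂ refl)

    extend* : List (Fm M) → Sequent → Sequent
    extend* [] s = s
    extend* (φ ∷ L) s = extend* L (extend φ s)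

    extend*-consistent : ∀ L s → Consistent s → Consistent (extend* L s)
    extend*-consistent [] s c = c
    extend*-consistent (φ ∷ L) s c = extend*-consistent L _ (extend-consistent φ s c)

    extend*-⊒ : ∀ L s → s ⊑ extend* L s
    extend*-⊒ [] s = (λ p → p) , (λ n → n)
    extend*-⊒ (φ ∷ L) s with extend-⊒ φ s | extend*-⊒ L (extend φ s)
    ... | l , r | l* , r* = (λ p → l* (l p)) , (λ n → r* (r n))

    extend*-decides : ∀ L s → φ ∈ L → lhs (extend* L s) φ ⊎ rhs (extend* L s) φ
    extend*-decides (φ ∷ L) s (here refl) =
      Sum.map (proj₁ (extend*-⊒ L _)) (proj₂ (extend*-⊒ L _)) (extend-decides φ s)
    extend*-decides (ψ ∷ L) s (there φ∈L) = extend*-decides L (extend ψ s) φ∈L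

    module Lindenbaum (Γ₀ Δ₀ : Pred (Fm M) 0ℓ) (c₀ : ¬ (_⊢_ Λ Γ₀ Δ₀)) where

      stage : ℕ → Sequent
      stage zero = Γ₀ ▹ Δ₀
      stage (suc n) = extend* (formulas n) (stage n)

      stage-consistent : ∀ n → Consistent (stage n)
      stage-consistent zero = c₀
      stage-consistent (suc n) = extend*-consistent (formulas n) (stage n) (stage-consistent n)

      module L = Ascending (λ n → lhs (stage n)) (λ n → proj₁ (extend*-⊒ (formulas n) (stage n)))
      module R = Ascending (λ n → rhs (stage n)) (λ n → proj₂ (extend*-⊒ (formulas n) (stage n)))

      limit : PrimeType Λ
      limit = record
        { pos = ⋃ ℕ (λ n → lhs (stage n))
        ; neg = ⋃ ℕ (λ n → rhs (stage n))
        ; cover = covers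
        ; cons = consistent
        }
        where
        covers : ∀ φ → ⋃ ℕ (λ n → lhs (stage n)) φ ⊎ ⋃ ℕ (λ n → rhs (stage n)) φ
        covers φ with formulas-complete φ
        ... | n , φ∈ = Sum.map (suc n ,_) (suc n ,_) (extend*-decides (formulas n) (stage n) φ∈)

        consistent : ¬ (_⊢_ Λ (⋃ ℕ (λ n → lhs (stage n))) (⋃ ℕ (λ n → rhs (stage n))))
        consistent (G , D , G⊆ , D⊆ , h) with L.All-⋃ G⊆ | R.All-⋃ D⊆
        ... | m , G⊆ₘ | n , D⊆ₙ =
          stage-consistent (m ⊔ n) (G , D , All.map (L.mono (m≤m⊔n m n)) G⊆ₘ ,
                                            All.map (R.mono (m≤n⊔m m n)) D⊆ₙ , h)

    lindenbaum : ¬ (_⊢_ Λ Γ Δ) → ∃[ Θ ] (Γ ⊆ pos Θ × Δ ⊆ neg Θ)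
    lindenbaum {Γ} {Δ} c = limit , (0 ,_) , (0 ,_)
      where open Lindenbaum Γ Δ c

    sensible-open : (∀ φ ψ → Λ ((○ φ ⇒ ○ ψ) ⇒ ○ (φ ⇒ ψ))) →
                    (Φ Φ′ Ψ : PrimeType Λ) → Sensible Λ Φ Φ′ → _≼_ Λ Φ′ Ψ →
                    ∃[ Θ ] (_≼_ Λ Φ Θ × Sensible Λ Θ Ψ)
    sensible-open ○⇒ Φ Φ′ Ψ s (Φ′⊆Ψ , _) with lindenbaum consistent
      where
      consistent : ¬ (_⊢_ Λ (pos Φ ∪ ○[ pos Ψ ]) ○[ neg Ψ ])
      consistent (G , D , G⊆ , D⊆ , h) with ⋀-split-∪ G⊆ | ⋁-○[] D⊆
      ... | G₁ , G₂ , G₁⊆ , G₂⊆ , g | D′ , D′⊆ , d with ⋀-○[] G₂⊆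
      ... | G₂′ , G₂′⊆ , g₂ = cons Ψ (⋁ D′ ∷ [] , D′ , ⋁D′∈Ψ ∷ [] , D′⊆ , ∧-fst)
        where
        in-Φ : pos Φ (○ (⋀ G₂′) ⇒ ○ (⋁ D′))
        in-Φ = pos-⋀-closed Φ G₁⊆
          (curry (⇒-trans (∧-map ⇒-refl g₂) (⇒-trans g (⇒-trans h d))))
        in-Ψ : pos Ψ (⋀ G₂′ ⇒ ⋁ D′)
        in-Ψ = Φ′⊆Ψ (Sensible.○⁺ s (pos-mp Φ in-Φ (○⇒ _ _)))
        ⋁D′∈Ψ : pos Ψ (⋁ D′)
        ⋁D′∈Ψ = pos-⋀-closed Ψ (in-Ψ ∷ G₂′⊆) (uncurry ⇒-refl)
    ... | Θ , Γ₀⊆ , Δ₀⊆ =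
      Θ , ≼-from-pos Φ Θ (λ p → Γ₀⊆ (inj₁ p)) ,
      sensible-from-○ Θ Ψ
        (λ {φ} p → ¬neg⇒pos Ψ λ n → pos-neg-disjoint Θ p (Δ₀⊆ (φ , refl , n)))
        (λ {φ} n → ¬pos⇒neg Ψ λ p → pos-neg-disjoint Θ (Γ₀⊆ (inj₂ (φ , refl , p))) n)

lemma5p5 : (M : Mods) (Λ : Pred (Fm M) 0ℓ) → IsAdmissible M Λ →
    -- S_c is total
    ((Φ : PrimeType Λ) → ∃[ Ψ ] Sensible Λ Φ Ψ)
    -- S_c is single-valued (equality of prime types = equality of both sets)
  × ((Φ Ψ₁ Ψ₂ : PrimeType Λ) → Sensible Λ Φ Ψ₁ → Sensible Λ Φ Ψ₂ →
       _≼_ Λ Ψ₁ Ψ₂ × _≼_ Λ Ψ₂ Ψ₁)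
    -- S_c is continuous (monotone)
  × ((Φ Ψ Φ' Ψ' : PrimeType Λ) → Sensible Λ Φ Φ' → Sensible Λ Ψ Ψ' →
       _≼_ Λ Φ Ψ → _≼_ Λ Φ' Ψ')
    -- S_c is open under the extra axiom (classical metatheory assumed)
  × (ExcludedMiddle 0ℓ →
     (∀ φ ψ → Λ ((○ φ ⇒ ○ ψ) ⇒ ○ (φ ⇒ ψ))) →
     (Φ Φ' Ψ : PrimeType Λ) → Sensible Λ Φ Φ' → _≼_ Λ Φ' Ψ →
     ∃[ Θ ] (_≼_ Λ Φ Θ × Sensible Λ Θ Ψ))
lemma5p5 M Λ adm =
  (λ Φ → next adm Φ , next-sensible adm Φ) ,
  (λ Φ Ψ₁ Ψ₂ s₁ s₂ → sensible-monotone adm Φ Φ Ψ₁ Ψ₂ s₁ s₂ (≼-refl adm Φ) ,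
                     sensible-monotone adm Φ Φ Ψ₂ Ψ₁ s₂ s₁ (≼-refl adm Φ)) ,
  sensible-monotone adm ,
  sensible-open adm
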